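{- Let $a,b,c$ be indeterminates (or numbers) and for $n\ge 0$ let $G_n(a,b,c)$ be the total weight of all G-Motzkin paths of length $n$, where the weight of a path is the product of the weights of its steps, with $\mathbf{u}$-steps weighted $1$, $\mathbf{h}$-steps weighted $a$, $\mathbf{v}$-steps weighted $b$ and $\mathbf{d}$-steps weighted $c$. Then for every integer $n\ge 0$, \[ G_n(a,b,c)=\sum_{k=0}^{n}\sum_{j=0}^{n-k}\binom{k}{j}\binom{n+k-j}{2k}C_k\,a^{n-k-j}b^{k-j}c^{j} =\sum_{k=0}^{n}\sum_{j=0}^{k}\binom{k}{j}\binom{n+j}{2k}C_k\,a^{n-2k+j}b^{j}c^{k-j} =\sum_{k=0}^{n}\sum_{j=0}^{n-k}\binom{2k+j}{j}\binom{k}{n-k-j}C_k\,a^{j}b^{2k+j-n}c^{n-k-j}, \] where $C_k=\frac{1}{k+1}\binom{2k}{k}$ is the $k$-th Catalan number.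
   Context: A G-Motzkin path of length $n$ is a lattice path from $(0,0)$ to $(n,0)$ that never goes below the $x$-axis and consists of up steps $\mathbf{u}=(1,1)$, down steps $\mathbf{d}=(1,-1)$, horizontal steps $\mathbf{h}=(1,0)$ and vertical steps $\mathbf{v}=(0,-1)$. The empty path is the unique G-Motzkin path of length $0$. -}

module Defs where

open import Level using (Level)
open import Data.Nat using (ℕ; zero; suc; _+_; _∸_; _*_; _/_)
open import Data.Nat.Combinatorics using (_C_)
open import Data.Bool using (Bool; true; false; _∧_; if_then_else_)
open import Data.List using (List; []; _∷_; map; concatMap; length)
import Data.Nat as ℕ
open import Algebra.Bundles using (CommutativeSemiring)
import Algebra.Definitions.RawSemiring as RS

-- Steps of a G-Motzkin path: u = (1,1), d = (1,-1), h = (1,0), v = (0,-1)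
data Step : Set where
  U D H V : Step

allSteps : List Step
allSteps = U ∷ D ∷ H ∷ V ∷ []

hlen : List Step → ℕ
hlen []      = 0
hlen (V ∷ p) = hlen p
hlen (_ ∷ p) = suc (hlen p)

staysAndReturns : ℕ → List Step → Bool
staysAndReturns zero    []      = true
staysAndReturns (suc _) []      = false
staysAndReturns h       (U ∷ p) = staysAndReturns (suc h) p
staysAndReturns h       (H ∷ p) = staysAndReturns h p
staysAndReturns zero    (D ∷ p) = false
staysAndReturns (suc h) (D ∷ p) = staysAndReturns h p
staysAndReturns zero    (V ∷ p) = false
staysAndReturns (suc h) (V ∷ p) = staysAndReturns h p

isGMotzkin : ℕ → List Step → Bool
isGMotzkin n p = (hlen p ℕ.≡ᵇ n) ∧ staysAndReturns 0 p

words : ℕ → List (List Step)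
words zero    = [] ∷ []
words (suc L) = concatMap (λ s → map (s ∷_) (words L)) allSteps

wordsUpTo : ℕ → List (List Step)
wordsUpTo zero    = words zero
wordsUpTo (suc L) = words (suc L) Data.List.++ wordsUpTo L

catalan : ℕ → ℕ
catalan k = ((2 * k) C k) / suc k

module Weighted {c ℓ : Level} (R : CommutativeSemiring c ℓ) where
  open CommutativeSemiring R renaming (_+_ to _⊕_; _*_ to _⊛_)
  open RS rawSemiring using (_×_; _^_)

  stepWeight : Carrier → Carrier → Carrier → Step → Carrier
  stepWeight a b c U = 1#
  stepWeight a b c H = a
  stepWeight a b c V = b
  stepWeight a b c D = c

  weight : Carrier → Carrier → Carrier → List Step → Carrier
  weight a b c []      = 1#
  weight a b c (s ∷ p) = stepWeight a b c s ⊛ weight a b c p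

  sumList : List Carrier → Carrier
  sumList []       = 0#
  sumList (x ∷ xs) = x ⊕ sumList xs

  -- A G-Motzkin path of length n has at most 2n steps
  -- (#steps = n + #v ≤ n + #u ≤ 2n), so all of them occur (exactly once)
  -- among the words with at most 2n steps.
  G : ℕ → Carrier → Carrier → Carrier → Carrier
  G n a b c = sumList (map (λ p → if isGMotzkin n p then weight a b c p else 0#)
                           (wordsUpTo (2 * n)))

  ∑ : ℕ → (ℕ → Carrier) → Carrier
  ∑ zero    f = f 0
  ∑ (suc n) f = ∑ n f ⊕ f (suc n)

  sum₁ sum₂ sum₃ : ℕ → Carrier → Carrier → Carrier → Carrier
  sum₁ n a b c = ∑ n (λ k → ∑ (n ∸ k) (λ j →
    ((k C j) * ((n + k ∸ j) C (2 * k)) * catalan k)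
      × (a ^ (n ∸ k ∸ j) ⊛ b ^ (k ∸ j) ⊛ c ^ j)))
  sum₂ n a b c = ∑ n (λ k → ∑ k (λ j →
    ((k C j) * ((n + j) C (2 * k)) * catalan k)
      × (a ^ (n + j ∸ 2 * k) ⊛ b ^ j ⊛ c ^ (k ∸ j))))
  sum₃ n a b c = ∑ n (λ k → ∑ (n ∸ k) (λ j →
    (((2 * k + j) C j) * (k C (n ∸ k ∸ j)) * catalan k)
      × (a ^ j ⊛ b ^ (2 * k + j ∸ n) ⊛ c ^ (n ∸ k ∸ j))))

-- A path from height h down to the axis with k u-steps, d d-steps and m h-steps has h + k − d
-- v-steps. Forgetting its h-steps leaves a ballot word of k up and h + k down steps, any d of whose
-- down steps may be the d-steps, and the h-steps can be spread freely over the h + 2k + 1 gaps; so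
-- there are B(k,h) C(h+k,d) C(h+2k+m,m) such paths, where B(k,h) = C(h+2k,k) − C(h+2k,k−1) is a
-- ballot number and B(k,0) = C_k. Rather than building this bijection, one checks that the resulting
-- weighted sum satisfies the first-step recurrence of the weighted path enumeration. Every step
-- lowers h + 2n, so the recurrence determines its solution, and at h = 0 this is the first formula.
-- The other two are the reindexings j ↦ k − j and j ↦ n − k − j of its inner sum.

module Submission where

open import Defs
open import Level using (Level)
open import Data.Nat using (ℕ)
open import Data.Product using (_×_; _,_)
open import Algebra.Bundles using (CommutativeSemiring)

module Ballot where
  open import Data.Nat using (zero; suc; _+_; _*_; _/_)
  open import Data.Nat.Properties
  open import Data.Nat.Combinatorics using (_C_; nCk+nC[k+1]≡[n+1]C[k+1]; nCk≡nC[n∸k]; nC1≡n)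
  open import Data.Nat.DivMod using (m*n/n≡m)
  open import Data.Nat.Solver using (module +-*-Solver)
  open import Relation.Binary.PropositionalEquality
  open ≡-Reasoning

  infixl 6.5 _C⁻_

  -- n C⁻ k is n C (k − 1); at k = 0 it is 0, not the n C 0 that truncated subtraction would give.
  _C⁻_ : ℕ → ℕ → ℕ
  n C⁻ zero  = 0
  n C⁻ suc k = n C k

  [1+n]Ck≡nC⁻k+nCk : ∀ n k → suc n C k ≡ n C⁻ k + n C k
  [1+n]Ck≡nC⁻k+nCk n zero    = refl
  [1+n]Ck≡nC⁻k+nCk n (suc k) = sym (nCk+nC[k+1]≡[n+1]C[k+1] n k)

  [m+n]Cn≡[m+n]Cm : ∀ m n → (m + n) C n ≡ (m + n) C m
  [m+n]Cn≡[m+n]Cm m n = trans (nCk≡nC[n∸k] (m≤n+m n m)) (cong ((m + n) C_) (m+n∸n≡m m n))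

  [1+k]*[1+n]C[1+k]≡[1+n]*nCk : ∀ n k → suc k * (suc n C suc k) ≡ suc n * (n C k)
  [1+k]*[1+n]C[1+k]≡[1+n]*nCk zero    zero    = refl
  [1+k]*[1+n]C[1+k]≡[1+n]*nCk zero    (suc k) = *-zeroʳ (suc (suc k))
  [1+k]*[1+n]C[1+k]≡[1+n]*nCk (suc n) zero    =
    trans (+-identityʳ _) (trans (nC1≡n (suc (suc n))) (sym (*-identityʳ (suc (suc n)))))
  [1+k]*[1+n]C[1+k]≡[1+n]*nCk (suc n) (suc k) = begin
    suc (suc k) * (suc (suc n) C suc (suc k))
      ≡⟨ cong (suc (suc k) *_) (nCk+nC[k+1]≡[n+1]C[k+1] (suc n) (suc k)) ⟨
    suc (suc k) * (A + A′)
      ≡⟨ *-distribˡ-+ (suc (suc k)) A A′ ⟩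
    (A + suc k * A) + suc (suc k) * A′
      ≡⟨ cong₂ (λ x y → (A + x) + y) ([1+k]*[1+n]C[1+k]≡[1+n]*nCk n k) ([1+k]*[1+n]C[1+k]≡[1+n]*nCk n (suc k)) ⟩
    (A + suc n * (n C k)) + suc n * (n C suc k)
      ≡⟨ +-assoc A _ _ ⟩
    A + (suc n * (n C k) + suc n * (n C suc k))
      ≡⟨ cong (A +_) (*-distribˡ-+ (suc n) (n C k) (n C suc k)) ⟨
    A + suc n * (n C k + n C suc k)
      ≡⟨ cong (λ x → A + suc n * x) (nCk+nC[k+1]≡[n+1]C[k+1] n k) ⟩
    suc (suc n) * A
      ∎
    where
    A  = suc n C suc k
    A′ = suc n C suc (suc k)

  2*k≡k+k : ∀ k → 2 * k ≡ k + k
  2*k≡k+k k = cong (k +_) (+-identityʳ k)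

  [2+k]*[2+2k]Ck≡[1+k]*[2+2k]C[1+k] :
    ∀ k → suc (suc k) * (suc (suc (k + k)) C k) ≡ suc k * (suc (suc (k + k)) C suc k)
  [2+k]*[2+2k]Ck≡[1+k]*[2+2k]C[1+k] k = begin
    suc (suc k) * (N C k)             ≡⟨ cong (suc (suc k) *_) ([m+n]Cn≡[m+n]Cm (suc (suc k)) k) ⟩
    suc (suc k) * (N C suc (suc k))   ≡⟨ [1+k]*[1+n]C[1+k]≡[1+n]*nCk (suc (k + k)) (suc k) ⟩
    N * (suc (k + k) C suc k)         ≡⟨ cong (N *_) ([m+n]Cn≡[m+n]Cm (suc k) k) ⟨
    N * (suc (k + k) C k)             ≡⟨ [1+k]*[1+n]C[1+k]≡[1+n]*nCk (suc (k + k)) k ⟨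
    suc k * (N C suc k)               ∎
    where N = suc (suc (k + k))

  -- ballot k h counts the words in k up steps and h + k down steps leading from height h to 0
  -- without going below 0; the clauses split on the first step.
  ballot : ℕ → ℕ → ℕ
  ballot zero    h       = 1
  ballot (suc k) zero    = ballot k 1
  ballot (suc k) (suc h) = ballot k (suc (suc h)) + ballot (suc k) h

  infixl 6 _+2*_

  -- h + 2k, by recursion on k so that it unfolds along ballot
  _+2*_ : ℕ → ℕ → ℕ
  h +2* zero  = h
  h +2* suc k = suc (suc (h +2* k))

  suc-+2* : ∀ h k → suc h +2* k ≡ suc (h +2* k)
  suc-+2* h zero    = refl
  suc-+2* h (suc k) = cong (λ x → suc (suc x)) (suc-+2* h k)

  0+2*k≡k+k : ∀ k → 0 +2* k ≡ k + k
  0+2*k≡k+k zero    = refl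
  0+2*k≡k+k (suc k) = cong suc (trans (cong suc (0+2*k≡k+k k)) (sym (+-suc k k)))

  ballot+C⁻≡C : ∀ k h → ballot k h + (h +2* k) C⁻ k ≡ (h +2* k) C k
  ballot+C⁻≡C zero    h       = refl
  ballot+C⁻≡C (suc k) zero    = begin
    ballot k 1 + suc N C k           ≡⟨ cong (ballot k 1 +_) ([1+n]Ck≡nC⁻k+nCk N k) ⟩
    ballot k 1 + (N C⁻ k + N C k)    ≡⟨ +-assoc (ballot k 1) _ _ ⟨
    ballot k 1 + N C⁻ k + N C k      ≡⟨ cong (_+ N C k) ih ⟩
    N C k + N C k                    ≡⟨ cong (N C k +_) central ⟩
    N C k + N C suc k                ≡⟨ nCk+nC[k+1]≡[n+1]C[k+1] N k ⟩
    suc N C suc k                    ∎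
    where
    N = suc (0 +2* k)
    ih : ballot k 1 + N C⁻ k ≡ N C k
    ih = subst (λ x → ballot k 1 + x C⁻ k ≡ x C k) (suc-+2* 0 k) (ballot+C⁻≡C k 1)
    central : N C k ≡ N C suc k
    central = subst (λ x → suc x C k ≡ suc x C suc k) (sym (0+2*k≡k+k k)) ([m+n]Cn≡[m+n]Cm (suc k) k)
  ballot+C⁻≡C (suc k) (suc h) = begin
    (B₁ + B₂) + suc (suc N) C k          ≡⟨ cong (λ x → (B₁ + B₂) + suc (suc x) C k) (suc-+2* h k) ⟩
    (B₁ + B₂) + suc M C k                ≡⟨ cong ((B₁ + B₂) +_) ([1+n]Ck≡nC⁻k+nCk M k) ⟩
    (B₁ + B₂) + (M C⁻ k + M C k)         ≡⟨ +-*-Solver.solve 4 (λ x y z w → (x :+ y) :+ (z :+ w) := (x :+ z) :+ (y :+ w))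
                                                              refl B₁ B₂ (M C⁻ k) (M C k) ⟩
    (B₁ + M C⁻ k) + (B₂ + M C k)         ≡⟨ cong₂ _+_ ih₁ (ballot+C⁻≡C (suc k) h) ⟩
    M C k + M C suc k                    ≡⟨ nCk+nC[k+1]≡[n+1]C[k+1] M k ⟩
    suc M C suc k                        ≡⟨ cong (λ x → suc (suc x) C suc k) (suc-+2* h k) ⟨
    suc (suc N) C suc k                  ∎
    where
    open +-*-Solver using (_:+_; _:=_)
    B₁ = ballot k (suc (suc h))
    B₂ = ballot (suc k) h
    N = suc h +2* k
    M = h +2* suc k
    ih₁ : B₁ + M C⁻ k ≡ M C k
    ih₁ = subst (λ x → B₁ + x C⁻ k ≡ x C k) (trans (suc-+2* (suc h) k) (cong suc (suc-+2* h k)))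
                (ballot+C⁻≡C k (suc (suc h)))

  [1+k]*ballot-k-0≡[2k]Ck : ∀ k → suc k * ballot k 0 ≡ (2 * k) C k
  [1+k]*ballot-k-0≡[2k]Ck zero    = refl
  [1+k]*ballot-k-0≡[2k]Ck (suc k) = begin
    suc K * B                         ≡⟨ +-cancelʳ-≡ (K * (N C K)) _ _ cancellable ⟩
    N C K                             ≡⟨ cong (_C K) 2K≡N ⟨
    (2 * K) C K                       ∎
    where
    K = suc k
    B = ballot K 0
    N = suc (suc (k + k))
    2K≡N : 2 * K ≡ N
    2K≡N = trans (2*k≡k+k K) (cong suc (+-suc k k))
    ballot-formula : B + N C k ≡ N C K
    ballot-formula = subst (λ x → B + suc (suc x) C k ≡ suc (suc x) C K) (0+2*k≡k+k k) (ballot+C⁻≡C K 0)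
    cancellable : suc K * B + K * (N C K) ≡ N C K + K * (N C K)
    cancellable = begin
      suc K * B + K * (N C K)        ≡⟨ cong (suc K * B +_) ([2+k]*[2+2k]Ck≡[1+k]*[2+2k]C[1+k] k) ⟨
      suc K * B + suc K * (N C k)    ≡⟨ *-distribˡ-+ (suc K) B (N C k) ⟨
      suc K * (B + N C k)            ≡⟨ cong (suc K *_) ballot-formula ⟩
      suc K * (N C K)                ∎

  ballot-k-0≡catalan : ∀ k → ballot k 0 ≡ catalan k
  ballot-k-0≡catalan k = begin
    ballot k 0                        ≡⟨ m*n/n≡m (ballot k 0) (suc k) ⟨
    ballot k 0 * suc k / suc k        ≡⟨ cong (_/ suc k) (*-comm (ballot k 0) (suc k)) ⟩
    suc k * ballot k 0 / suc k        ≡⟨ cong (_/ suc k) ([1+k]*ballot-k-0≡[2k]Ck k) ⟩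
    catalan k                         ∎

  0+2*k≡2*k : ∀ k → 0 +2* k ≡ 2 * k
  0+2*k≡2*k k = trans (0+2*k≡k+k k) (sym (2*k≡k+k k))

module PathCount where
  open import Data.Nat using (zero; suc; _+_; _*_; _<_)
  open import Data.Nat.Properties
  open import Data.Nat.Combinatorics using (_C_; nCk+nC[k+1]≡[n+1]C[k+1]; nCn≡1; k>n⇒nCk≡0)
  open import Data.Nat.Solver using (module +-*-Solver)
  open import Data.List using (map)
  open import Data.Nat.ListAction using (sum)
  open import Relation.Binary.PropositionalEquality
  open ≡-Reasoning

  open Ballot

  skeletonCount : ℕ → ℕ → ℕ → ℕ
  skeletonCount h k d = ballot k h * ((h + k) C d)

  levelPlacements : ℕ → ℕ → ℕ
  levelPlacements s m = (s + m) C m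

  pathCount : ℕ → ℕ → ℕ → ℕ → ℕ
  pathCount h k d m = skeletonCount h k d * levelPlacements (h +2* k) m

  emptyCount : ℕ → ℕ → ℕ → ℕ → ℕ
  emptyCount zero zero zero zero = 1
  emptyCount _    _    _    _    = 0

  countAfter : Step → ℕ → ℕ → ℕ → ℕ → ℕ
  countAfter U h       (suc k) d       m       = pathCount (suc h) k d m
  countAfter D (suc h) k       (suc d) m       = pathCount h k d m
  countAfter H h       k       d       (suc m) = pathCount h k d m
  countAfter V (suc h) k       d       m       = pathCount h k d m
  countAfter _ _       _       _       _       = 0

  pathCount-vanishes : ∀ h k d m → h + k < d → pathCount h k d m ≡ 0
  pathCount-vanishes h k d m h+k<d = begin
    ballot k h * ((h + k) C d) * L  ≡⟨ cong (λ x → ballot k h * x * L) (k>n⇒nCk≡0 h+k<d) ⟩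
    ballot k h * 0 * L              ≡⟨ cong (_* L) (*-zeroʳ (ballot k h)) ⟩
    0                               ∎
    where L = levelPlacements (h +2* k) m

  levelPlacements-pascal :
    ∀ s m → levelPlacements (suc s) (suc m) ≡ levelPlacements s (suc m) + levelPlacements (suc s) m
  levelPlacements-pascal s m = begin
    suc (s + suc m) C suc m                ≡⟨ nCk+nC[k+1]≡[n+1]C[k+1] (s + suc m) m ⟨
    (s + suc m) C m + (s + suc m) C suc m  ≡⟨ +-comm ((s + suc m) C m) _ ⟩
    (s + suc m) C suc m + (s + suc m) C m  ≡⟨ cong (λ x → (s + suc m) C suc m + x C m) (+-suc s m) ⟩
    (s + suc m) C suc m + suc (s + m) C m  ∎

  pathCount-levelSplit : ∀ h k d m {T} → h +2* k ≡ suc T →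
    pathCount h k d m ≡ skeletonCount h k d * levelPlacements T m + countAfter H h k d m
  pathCount-levelSplit h k d zero    _  = sym (+-identityʳ _)
  pathCount-levelSplit h k d (suc m) {T} eq = begin
    S * levelPlacements (h +2* k) (suc m)
      ≡⟨ cong (λ x → S * levelPlacements x (suc m)) eq ⟩
    S * levelPlacements (suc T) (suc m)
      ≡⟨ cong (S *_) (levelPlacements-pascal T m) ⟩
    S * (levelPlacements T (suc m) + levelPlacements (suc T) m)
      ≡⟨ *-distribˡ-+ S _ _ ⟩
    S * levelPlacements T (suc m) + S * levelPlacements (suc T) m
      ≡⟨ cong (λ x → S * levelPlacements T (suc m) + S * levelPlacements x m) eq ⟨
    S * levelPlacements T (suc m) + S * levelPlacements (h +2* k) m
      ∎
    where S = skeletonCount h k d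

  countAfterD+countAfterV : ∀ h k d m →
    countAfter D (suc h) k d m + countAfter V (suc h) k d m ≡ ballot k h * ((suc h + k) C d) * levelPlacements (h +2* k) m
  countAfterD+countAfterV h k d m = begin
    countAfter D (suc h) k d m + ballot k h * ((h + k) C d) * L
      ≡⟨ cong (_+ ballot k h * ((h + k) C d) * L) (countAfterD≡ d) ⟩
    ballot k h * ((h + k) C⁻ d) * L + ballot k h * ((h + k) C d) * L
      ≡⟨ *-distribʳ-+ L (ballot k h * ((h + k) C⁻ d)) _ ⟨
    (ballot k h * ((h + k) C⁻ d) + ballot k h * ((h + k) C d)) * L
      ≡⟨ cong (_* L) (*-distribˡ-+ (ballot k h) ((h + k) C⁻ d) _) ⟨
    ballot k h * ((h + k) C⁻ d + (h + k) C d) * L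
      ≡⟨ cong (λ x → ballot k h * x * L) ([1+n]Ck≡nC⁻k+nCk (h + k) d) ⟨
    ballot k h * ((suc h + k) C d) * L
      ∎
    where
    L = levelPlacements (h +2* k) m
    countAfterD≡ : ∀ d → countAfter D (suc h) k d m ≡ ballot k h * ((h + k) C⁻ d) * L
    countAfterD≡ zero    = sym (trans (cong (_* L) (*-zeroʳ (ballot k h))) (*-zeroˡ L))
    countAfterD≡ (suc d) = refl

  skeletonCount-firstStep : ∀ h k d m →
    skeletonCount (suc h) k d * levelPlacements (h +2* k) m
      ≡ countAfter U (suc h) k d m + (countAfter D (suc h) k d m + countAfter V (suc h) k d m)
  skeletonCount-firstStep h zero    d m = sym (countAfterD+countAfterV h zero d m)
  skeletonCount-firstStep h (suc k) d m = begin
    (ballot k (suc (suc h)) + ballot (suc k) h) * X * L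
      ≡⟨ cong (_* L) (*-distribʳ-+ X (ballot k (suc (suc h))) _) ⟩
    (ballot k (suc (suc h)) * X + ballot (suc k) h * X) * L
      ≡⟨ *-distribʳ-+ L (ballot k (suc (suc h)) * X) _ ⟩
    ballot k (suc (suc h)) * X * L + ballot (suc k) h * X * L
      ≡⟨ cong₂ _+_ (cong₂ (λ x y → ballot k (suc (suc h)) * (x C d) * levelPlacements y m)
                          (cong suc (+-suc h k)) h+2*[1+k]≡[2+h]+2*k)
                   (sym (countAfterD+countAfterV h (suc k) d m)) ⟩
    countAfter U (suc h) (suc k) d m + (countAfter D (suc h) (suc k) d m + countAfter V (suc h) (suc k) d m)
      ∎
    where
    X = (suc h + suc k) C d
    L = levelPlacements (h +2* suc k) m
    h+2*[1+k]≡[2+h]+2*k : h +2* suc k ≡ suc (suc h) +2* k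
    h+2*[1+k]≡[2+h]+2*k = sym (trans (suc-+2* (suc h) k) (cong suc (suc-+2* h k)))

  pathCount-firstStep : ∀ h k d m →
    pathCount h k d m ≡ emptyCount h k d m + sum (map (λ s → countAfter s h k d m) allSteps)
  pathCount-firstStep zero zero zero    zero    = refl
  pathCount-firstStep zero zero zero    (suc m) = begin
    suc m C suc m + 0             ≡⟨ cong (_+ 0) (trans (nCn≡1 (suc m)) (sym (nCn≡1 m))) ⟩
    m C m + 0                     ≡⟨ +-identityʳ (m C m + 0) ⟨
    m C m + 0 + 0                 ∎
  pathCount-firstStep zero zero (suc d) zero    = refl
  pathCount-firstStep zero zero (suc d) (suc m) = refl
  pathCount-firstStep zero (suc k) d m = begin
    pathCount 0 (suc k) d m       ≡⟨ pathCount-levelSplit 0 (suc k) d m (cong suc (sym (suc-+2* 0 k))) ⟩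
    cU + cH                       ≡⟨ cong (cU +_) (+-identityʳ cH) ⟨
    cU + (cH + 0)                 ∎
    where
    cU = countAfter U 0 (suc k) d m
    cH = countAfter H 0 (suc k) d m
  pathCount-firstStep (suc h) k d m = begin
    pathCount (suc h) k d m       ≡⟨ pathCount-levelSplit (suc h) k d m (suc-+2* h k) ⟩
    skeletonCount (suc h) k d * levelPlacements (h +2* k) m + cH
                                  ≡⟨ cong (_+ cH) (skeletonCount-firstStep h k d m) ⟩
    (cU + (cD + cV)) + cH         ≡⟨ +-*-Solver.solve 4 (λ u d h v → (u :+ (d :+ v)) :+ h := u :+ (d :+ (h :+ (v :+ con 0))))
                                                          refl cU cD cH cV ⟩
    cU + (cD + (cH + (cV + 0)))   ∎
    where
    cU = countAfter U (suc h) k d m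
    cD = countAfter D (suc h) k d m
    cH = countAfter H (suc h) k d m
    cV = countAfter V (suc h) k d m
    open +-*-Solver using (_:+_; _:=_; con)

module Sums {c ℓ : Level} (R : CommutativeSemiring c ℓ) where
  open import Data.Nat using (zero; suc; _∸_; _≤_; _<_; z≤n)
  import Data.Nat.Properties as ℕ
  open import Data.Nat.ListAction using (sum)
  open import Data.List using (List; []; _∷_; map; _++_; concatMap)
  open import Data.Sum using (inj₁; inj₂)
  import Relation.Binary.PropositionalEquality as ≡
  open CommutativeSemiring R hiding (zero) renaming (_+_ to _⊕_; _*_ to _⊛_)
  open import Algebra.Definitions.RawSemiring rawSemiring using () renaming (_×_ to _·_)
  open import Algebra.Properties.Monoid.Mult +-monoid using (×-homo-+)
  open import Algebra.Properties.CommutativeSemigroup +-commutativeSemigroup using (interchange)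
  open Weighted R
  open import Relation.Binary.Reasoning.Setoid setoid

  ∑-cong : ∀ n {f g : ℕ → Carrier} → (∀ i → i ≤ n → f i ≈ g i) → ∑ n f ≈ ∑ n g
  ∑-cong zero    f≈g = f≈g 0 z≤n
  ∑-cong (suc n) f≈g = +-cong (∑-cong n (λ i i≤n → f≈g i (ℕ.m≤n⇒m≤1+n i≤n))) (f≈g (suc n) ℕ.≤-refl)

  ∑-distrib-⊕ : ∀ n (f g : ℕ → Carrier) → ∑ n (λ i → f i ⊕ g i) ≈ ∑ n f ⊕ ∑ n g
  ∑-distrib-⊕ zero    f g = refl
  ∑-distrib-⊕ (suc n) f g =
    trans (+-congʳ (∑-distrib-⊕ n f g)) (interchange (∑ n f) (∑ n g) (f (suc n)) (g (suc n)))

  *-distribˡ-∑ : ∀ n x (f : ℕ → Carrier) → x ⊛ ∑ n f ≈ ∑ n (λ i → x ⊛ f i)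
  *-distribˡ-∑ zero    x f = refl
  *-distribˡ-∑ (suc n) x f = trans (distribˡ x (∑ n f) (f (suc n))) (+-congʳ (*-distribˡ-∑ n x f))

  ∑-zero : ∀ n {f : ℕ → Carrier} → (∀ i → i ≤ n → f i ≈ 0#) → ∑ n f ≈ 0#
  ∑-zero zero    f≈0 = f≈0 0 z≤n
  ∑-zero (suc n) f≈0 =
    trans (+-cong (∑-zero n (λ i i≤n → f≈0 i (ℕ.m≤n⇒m≤1+n i≤n))) (f≈0 (suc n) ℕ.≤-refl)) (+-identityʳ 0#)

  ∑-suc : ∀ n (f : ℕ → Carrier) → ∑ (suc n) f ≈ f 0 ⊕ ∑ n (λ i → f (suc i))
  ∑-suc zero    f = refl
  ∑-suc (suc n) f = trans (+-congʳ (∑-suc n f)) (+-assoc _ _ _)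

  ∑-dropLast : ∀ n (f : ℕ → Carrier) → f (suc n) ≈ 0# → ∑ (suc n) f ≈ ∑ n f
  ∑-dropLast n f fₙ≈0 = trans (+-congˡ fₙ≈0) (+-identityʳ _)

  ∑-truncate : ∀ {p} q (f : ℕ → Carrier) → p ≤ q → (∀ j → p < j → j ≤ q → f j ≈ 0#) → ∑ q f ≈ ∑ p f
  ∑-truncate zero    f z≤n _   = refl
  ∑-truncate (suc q) f p≤q f≈0 with ℕ.m≤n⇒m<n∨m≡n p≤q
  ... | inj₁ p<q    = trans (∑-dropLast q f (f≈0 (suc q) p<q ℕ.≤-refl))
                            (∑-truncate q f (ℕ.≤-pred p<q) (λ j p<j j≤q → f≈0 j p<j (ℕ.m≤n⇒m≤1+n j≤q)))
  ... | inj₂ ≡.refl = refl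

  ∑-reverse : ∀ n (f : ℕ → Carrier) → ∑ n f ≈ ∑ n (λ i → f (n ∸ i))
  ∑-reverse zero    f = refl
  ∑-reverse (suc n) f = begin
    ∑ n f ⊕ f (suc n)                          ≈⟨ +-congʳ (∑-reverse n f) ⟩
    ∑ n (λ i → f (n ∸ i)) ⊕ f (suc n)          ≈⟨ +-comm _ _ ⟩
    f (suc n) ⊕ ∑ n (λ i → f (suc n ∸ suc i))  ≈⟨ ∑-suc n (λ i → f (suc n ∸ i)) ⟨
    ∑ (suc n) (λ i → f (suc n ∸ i))            ∎

  sumList-map-cong : ∀ {A : Set} {f g : A → Carrier} xs → (∀ x → f x ≈ g x) →
    sumList (map f xs) ≈ sumList (map g xs)
  sumList-map-cong []       f≈g = refl
  sumList-map-cong (x ∷ xs) f≈g = +-cong (f≈g x) (sumList-map-cong xs f≈g)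

  sumList-map-++ : ∀ {A : Set} (f : A → Carrier) xs ys →
    sumList (map f (xs ++ ys)) ≈ sumList (map f xs) ⊕ sumList (map f ys)
  sumList-map-++ f []       ys = sym (+-identityˡ _)
  sumList-map-++ f (x ∷ xs) ys = trans (+-congˡ (sumList-map-++ f xs ys)) (sym (+-assoc _ _ _))

  sumList-map-concatMap : ∀ {A B : Set} (f : B → Carrier) (g : A → List B) xs →
    sumList (map f (concatMap g xs)) ≈ sumList (map (λ x → sumList (map f (g x))) xs)
  sumList-map-concatMap f g []       = refl
  sumList-map-concatMap f g (x ∷ xs) =
    trans (sumList-map-++ f (g x) (concatMap g xs)) (+-congˡ (sumList-map-concatMap f g xs))

  sumList-map-⊕ : ∀ {A : Set} (f g : A → Carrier) xs →
    sumList (map (λ x → f x ⊕ g x) xs) ≈ sumList (map f xs) ⊕ sumList (map g xs)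
  sumList-map-⊕ f g []       = sym (+-identityˡ 0#)
  sumList-map-⊕ f g (x ∷ xs) =
    trans (+-congˡ (sumList-map-⊕ f g xs)) (interchange (f x) (g x) _ _)

  ∑-sumList : ∀ n {A : Set} (F : A → ℕ → Carrier) xs →
    ∑ n (λ i → sumList (map (λ x → F x i) xs)) ≈ sumList (map (λ x → ∑ n (F x)) xs)
  ∑-sumList n F []       = ∑-zero n (λ _ _ → refl)
  ∑-sumList n F (x ∷ xs) = trans (∑-distrib-⊕ n (F x) _) (+-congˡ (∑-sumList n F xs))

  sum-·-distrib : ∀ {A : Set} (f : A → ℕ) xs y → sum (map f xs) · y ≈ sumList (map (λ x → f x · y) xs)
  sum-·-distrib f []       y = refl
  sum-·-distrib f (x ∷ xs) y = trans (×-homo-+ y (f x) _) (+-congˡ (sum-·-distrib f xs y))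

module Enumeration {c ℓ : Level} (R : CommutativeSemiring c ℓ) where
  open import Data.Nat using (zero; suc; _*_; _≤_; _≡ᵇ_)
  import Data.Nat.Properties as ℕ
  open import Data.Bool using (true; false; _∧_; if_then_else_)
  open import Data.Bool.Properties using (∧-zeroʳ)
  open import Data.List using (List; []; _∷_; map)
  import Data.List.Properties as List
  import Relation.Binary.PropositionalEquality as ≡
  open CommutativeSemiring R hiding (zero) renaming (_+_ to _⊕_; _*_ to _⊛_)
  open Weighted R
  open Sums R
  open Ballot using (_+2*_; suc-+2*; 0+2*k≡2*k)
  open import Relation.Binary.Reasoning.Setoid setoid

  module _ (a b c : Carrier) where

    pathWeight : ℕ → ℕ → List Step → Carrier
    pathWeight h n p = if (hlen p ≡ᵇ n) ∧ staysAndReturns h p then weight a b c p else 0#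

    emptyWeight : ℕ → ℕ → Carrier
    emptyWeight zero zero = 1#
    emptyWeight _    _    = 0#

    -- If Z h n is the total weight of the paths of length n from height h to the axis,
    -- after s Z h n is the weight of those starting with step s.
    after : Step → (ℕ → ℕ → Carrier) → ℕ → ℕ → Carrier
    after U Z h       (suc n) = Z (suc h) n
    after D Z (suc h) (suc n) = c ⊛ Z h n
    after H Z h       (suc n) = a ⊛ Z h n
    after V Z (suc h) n       = b ⊛ Z h n
    after _ _ _       _       = 0#

    firstStep : (ℕ → ℕ → Carrier) → ℕ → ℕ → Carrier
    firstStep Z h n = sumList (map (λ s → after s Z h n) allSteps)

    IsFirstStepSolution : (ℕ → ℕ → Carrier) → Set _
    IsFirstStepSolution Z = ∀ h n → Z h n ≈ emptyWeight h n ⊕ firstStep Z h n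

    if-then-else-* : ∀ β x y → (if β then x ⊛ y else 0#) ≈ x ⊛ (if β then y else 0#)
    if-then-else-* true  x y = refl
    if-then-else-* false x y = sym (zeroʳ x)

    pathWeight-[] : ∀ h n → pathWeight h n [] ≈ emptyWeight h n
    pathWeight-[] zero    zero    = refl
    pathWeight-[] zero    (suc n) = refl
    pathWeight-[] (suc h) zero    = refl
    pathWeight-[] (suc h) (suc n) = refl

    pathWeight-∷ : ∀ s h n p → pathWeight h n (s ∷ p) ≈ after s (λ h′ n′ → pathWeight h′ n′ p) h n
    pathWeight-∷ U h       zero    p = refl
    pathWeight-∷ U zero    (suc n) p = trans (if-then-else-* _ 1# _) (*-identityˡ _)
    pathWeight-∷ U (suc h) (suc n) p = trans (if-then-else-* _ 1# _) (*-identityˡ _)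
    pathWeight-∷ D zero    n       p =
      reflexive (≡.cong (λ β → if β then c ⊛ weight a b c p else 0#) (∧-zeroʳ (suc (hlen p) ≡ᵇ n)))
    pathWeight-∷ D (suc h) zero    p = refl
    pathWeight-∷ D (suc h) (suc n) p = if-then-else-* _ c _
    pathWeight-∷ H h       zero    p = refl
    pathWeight-∷ H zero    (suc n) p = if-then-else-* _ a _
    pathWeight-∷ H (suc h) (suc n) p = if-then-else-* _ a _
    pathWeight-∷ V zero    n       p =
      reflexive (≡.cong (λ β → if β then b ⊛ weight a b c p else 0#) (∧-zeroʳ (hlen p ≡ᵇ n)))
    pathWeight-∷ V (suc h) n       p = if-then-else-* _ b _

    after-⊕ : ∀ s {X Y Z : ℕ → ℕ → Carrier} → (∀ h n → Z h n ≈ X h n ⊕ Y h n) →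
      ∀ h n → after s Z h n ≈ after s X h n ⊕ after s Y h n
    after-⊕ U Z≈X⊕Y h       zero    = sym (+-identityˡ 0#)
    after-⊕ U Z≈X⊕Y h       (suc n) = Z≈X⊕Y (suc h) n
    after-⊕ D Z≈X⊕Y zero    n       = sym (+-identityˡ 0#)
    after-⊕ D Z≈X⊕Y (suc h) zero    = sym (+-identityˡ 0#)
    after-⊕ D Z≈X⊕Y (suc h) (suc n) = trans (*-congˡ (Z≈X⊕Y h n)) (distribˡ c _ _)
    after-⊕ H Z≈X⊕Y h       zero    = sym (+-identityˡ 0#)
    after-⊕ H Z≈X⊕Y h       (suc n) = trans (*-congˡ (Z≈X⊕Y h n)) (distribˡ a _ _)
    after-⊕ V Z≈X⊕Y zero    n       = sym (+-identityˡ 0#)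
    after-⊕ V Z≈X⊕Y (suc h) n       = trans (*-congˡ (Z≈X⊕Y h n)) (distribˡ b _ _)

    after-zero : ∀ s h n → after s (λ _ _ → 0#) h n ≈ 0#
    after-zero U h       zero    = refl
    after-zero U h       (suc n) = refl
    after-zero D zero    n       = refl
    after-zero D (suc h) zero    = refl
    after-zero D (suc h) (suc n) = zeroʳ c
    after-zero H h       zero    = refl
    after-zero H h       (suc n) = zeroʳ a
    after-zero V zero    n       = refl
    after-zero V (suc h) n       = zeroʳ b

    after-sumList : ∀ s {A : Set} (Z : A → ℕ → ℕ → Carrier) xs h n →
      sumList (map (λ x → after s (Z x) h n) xs) ≈ after s (λ h′ n′ → sumList (map (λ x → Z x h′ n′) xs)) h n
    after-sumList s Z []       h n = sym (after-zero s h n)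
    after-sumList s Z (x ∷ xs) h n =
      trans (+-congˡ (after-sumList s Z xs h n)) (sym (after-⊕ s (λ _ _ → refl) h n))

    -- Each step lowers h + 2n by 1 or 2, so Z and Z′ need only agree below the bound.
    after-cong-below : ∀ s {L} {Z Z′ : ℕ → ℕ → Carrier} → (∀ h n → h +2* n ≤ L → Z h n ≈ Z′ h n) →
      ∀ h n → h +2* n ≤ suc L → after s Z h n ≈ after s Z′ h n
    after-cong-below U Z≈Z′ h       zero    _ = refl
    after-cong-below U Z≈Z′ h       (suc n) bound =
      Z≈Z′ (suc h) n (≡.subst (_≤ _) (≡.sym (suc-+2* h n)) (ℕ.≤-pred bound))
    after-cong-below D Z≈Z′ zero    n       _ = refl
    after-cong-below D Z≈Z′ (suc h) zero    _ = refl
    after-cong-below D Z≈Z′ (suc h) (suc n) bound =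
      *-congˡ (Z≈Z′ h n (ℕ.<⇒≤ (≡.subst (_≤ _) (suc-+2* h n) (ℕ.<⇒≤ (ℕ.≤-pred bound)))))
    after-cong-below H Z≈Z′ h       zero    _ = refl
    after-cong-below H Z≈Z′ h       (suc n) bound = *-congˡ (Z≈Z′ h n (ℕ.<⇒≤ (ℕ.≤-pred bound)))
    after-cong-below V Z≈Z′ zero    n       _ = refl
    after-cong-below V Z≈Z′ (suc h) n       bound =
      *-congˡ (Z≈Z′ h n (ℕ.≤-pred (≡.subst (_≤ _) (suc-+2* h n) bound)))

    firstStep-⊕ : ∀ {X Y Z : ℕ → ℕ → Carrier} → (∀ h n → Z h n ≈ X h n ⊕ Y h n) →
      ∀ h n → firstStep Z h n ≈ firstStep X h n ⊕ firstStep Y h n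
    firstStep-⊕ {X} {Y} Z≈X⊕Y h n =
      trans (sumList-map-cong allSteps (λ s → after-⊕ s Z≈X⊕Y h n))
            (sumList-map-⊕ (λ s → after s X h n) (λ s → after s Y h n) allSteps)

    firstStep-cong-below : ∀ {L} {Z Z′ : ℕ → ℕ → Carrier} → (∀ h n → h +2* n ≤ L → Z h n ≈ Z′ h n) →
      ∀ h n → h +2* n ≤ suc L → firstStep Z h n ≈ firstStep Z′ h n
    firstStep-cong-below Z≈Z′ h n bound =
      sumList-map-cong allSteps (λ s → after-cong-below s Z≈Z′ h n bound)

    wordSum wordSumUpTo : ℕ → ℕ → ℕ → Carrier
    wordSum     L h n = sumList (map (pathWeight h n) (words L))
    wordSumUpTo L h n = sumList (map (pathWeight h n) (wordsUpTo L))

    wordSum-zero : ∀ h n → wordSum 0 h n ≈ emptyWeight h n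
    wordSum-zero h n = trans (+-identityʳ _) (pathWeight-[] h n)

    wordSum-suc : ∀ L h n → wordSum (suc L) h n ≈ firstStep (wordSum L) h n
    wordSum-suc L h n = trans (sumList-map-concatMap (pathWeight h n) (λ s → map (s ∷_) (words L)) allSteps)
                              (sumList-map-cong allSteps byStep)
      where
      byStep : ∀ s → sumList (map (pathWeight h n) (map (s ∷_) (words L))) ≈ after s (wordSum L) h n
      byStep s = begin
        sumList (map (pathWeight h n) (map (s ∷_) (words L)))
          ≡⟨ ≡.cong sumList (List.map-∘ (words L)) ⟨
        sumList (map (λ p → pathWeight h n (s ∷ p)) (words L))
          ≈⟨ sumList-map-cong (words L) (pathWeight-∷ s h n) ⟩
        sumList (map (λ p → after s (λ h′ n′ → pathWeight h′ n′ p) h n) (words L))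
          ≈⟨ after-sumList s (λ p h′ n′ → pathWeight h′ n′ p) (words L) h n ⟩
        after s (wordSum L) h n
          ∎

    wordSumUpTo-suc : ∀ L h n → wordSumUpTo (suc L) h n ≈ wordSum (suc L) h n ⊕ wordSumUpTo L h n
    wordSumUpTo-suc L h n = sumList-map-++ (pathWeight h n) (words (suc L)) (wordsUpTo L)

    wordSumUpTo-firstStep : ∀ L h n → wordSumUpTo (suc L) h n ≈ emptyWeight h n ⊕ firstStep (wordSumUpTo L) h n
    wordSumUpTo-firstStep zero    h n = begin
      wordSumUpTo 1 h n                                  ≈⟨ wordSumUpTo-suc 0 h n ⟩
      wordSum 1 h n ⊕ wordSum 0 h n                      ≈⟨ +-cong (wordSum-suc 0 h n) (wordSum-zero h n) ⟩
      firstStep (wordSum 0) h n ⊕ emptyWeight h n        ≈⟨ +-comm _ _ ⟩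
      emptyWeight h n ⊕ firstStep (wordSumUpTo 0) h n    ∎
    wordSumUpTo-firstStep (suc L) h n = begin
      wordSumUpTo (suc (suc L)) h n
        ≈⟨ wordSumUpTo-suc (suc L) h n ⟩
      wordSum (suc (suc L)) h n ⊕ wordSumUpTo (suc L) h n
        ≈⟨ +-cong (wordSum-suc (suc L) h n) (wordSumUpTo-firstStep L h n) ⟩
      firstStep (wordSum (suc L)) h n ⊕ (emptyWeight h n ⊕ firstStep (wordSumUpTo L) h n)
        ≈⟨ +-assoc _ _ _ ⟨
      (firstStep (wordSum (suc L)) h n ⊕ emptyWeight h n) ⊕ firstStep (wordSumUpTo L) h n
        ≈⟨ +-congʳ (+-comm _ _) ⟩
      (emptyWeight h n ⊕ firstStep (wordSum (suc L)) h n) ⊕ firstStep (wordSumUpTo L) h n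
        ≈⟨ +-assoc _ _ _ ⟩
      emptyWeight h n ⊕ (firstStep (wordSum (suc L)) h n ⊕ firstStep (wordSumUpTo L) h n)
        ≈⟨ +-congˡ (firstStep-⊕ (wordSumUpTo-suc L) h n) ⟨
      emptyWeight h n ⊕ firstStep (wordSumUpTo (suc L)) h n
        ∎

    firstStep-origin : ∀ Z → firstStep Z 0 0 ≈ 0#
    firstStep-origin Z = trans (+-identityˡ _) (trans (+-identityˡ _) (trans (+-identityˡ _) (+-identityˡ _)))

    -- Words of more than h + 2n steps are never paths from height h of length n.
    wordSumUpTo≈solution : ∀ {Z} → IsFirstStepSolution Z → ∀ L h n → h +2* n ≤ L → wordSumUpTo L h n ≈ Z h n
    wordSumUpTo≈solution {Z} solves zero    zero zero _ = begin
      wordSumUpTo 0 0 0                   ≈⟨ wordSum-zero 0 0 ⟩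
      1#                                  ≈⟨ +-identityʳ 1# ⟨
      1# ⊕ 0#                             ≈⟨ +-congˡ (firstStep-origin Z) ⟨
      emptyWeight 0 0 ⊕ firstStep Z 0 0   ≈⟨ solves 0 0 ⟨
      Z 0 0                               ∎
    wordSumUpTo≈solution {Z} solves (suc L) h n bound = begin
      wordSumUpTo (suc L) h n                         ≈⟨ wordSumUpTo-firstStep L h n ⟩
      emptyWeight h n ⊕ firstStep (wordSumUpTo L) h n
        ≈⟨ +-congˡ (firstStep-cong-below (wordSumUpTo≈solution solves L) h n bound) ⟩
      emptyWeight h n ⊕ firstStep Z h n               ≈⟨ solves h n ⟨
      Z h n                                           ∎

    G≈solution : ∀ {Z} → IsFirstStepSolution Z → ∀ n → G n a b c ≈ Z 0 n
    G≈solution solves n =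
      wordSumUpTo≈solution solves (2 * n) 0 n (ℕ.≤-reflexive (0+2*k≡2*k n))

module ClosedForm {c ℓ : Level} (R : CommutativeSemiring c ℓ) where
  open import Data.Nat using (zero; suc; _+_; _∸_; _≤_)
  import Data.Nat.Properties as ℕ
  open import Data.List using (map)
  open import Data.Nat.ListAction using (sum)
  open import Relation.Nullary using (yes; no)
  open import Relation.Binary.PropositionalEquality as ≡ using (_≡_)
  open CommutativeSemiring R hiding (zero) renaming (_+_ to _⊕_; _*_ to _⊛_)
  open import Algebra.Definitions.RawSemiring rawSemiring using (_^_) renaming (_×_ to _·_)
  open import Algebra.Properties.Monoid.Mult +-monoid using (×-homo-+; ×-congʳ)
  open import Algebra.Properties.Semiring.Mult semiring using (×-comm-*)
  open Weighted R
  open Sums R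
  open Enumeration R
  open PathCount using (pathCount; emptyCount; countAfter; pathCount-firstStep; pathCount-vanishes)
  open import Relation.Binary.Reasoning.Setoid setoid

  Count : Set
  Count = ℕ → ℕ → ℕ → ℕ → ℕ

  module _ (a b c : Carrier) where

    -- The weight of a path from height h with k u-steps, d d-steps and r − d h-steps.
    monomial : ℕ → ℕ → ℕ → ℕ → Carrier
    monomial h k r d = a ^ (r ∸ d) ⊛ b ^ (h + k ∸ d) ⊛ c ^ d

    weightedₖ : Count → ℕ → ℕ → ℕ → Carrier
    weightedₖ f h k r = ∑ r (λ d → f h k d (r ∸ d) · monomial h k r d)

    weighted : Count → ℕ → ℕ → Carrier
    weighted f h n = ∑ n (λ k → weightedₖ f h k (n ∸ k))

    closedForm : ℕ → ℕ → Carrier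
    closedForm = weighted pathCount

    ·-pull : ∀ m x {y z} → y ≈ x ⊛ z → m · y ≈ x ⊛ (m · z)
    ·-pull m x y≈xz = trans (×-congʳ m y≈xz) (sym (×-comm-* m x _))

    monomial-u : ∀ h k r d → monomial h (suc k) r d ≡ monomial (suc h) k r d
    monomial-u h k r d = ≡.cong (λ x → a ^ (r ∸ d) ⊛ b ^ (x ∸ d) ⊛ c ^ d) (ℕ.+-suc h k)

    monomial-d : ∀ h k r d → monomial (suc h) k (suc r) (suc d) ≈ c ⊛ monomial h k r d
    monomial-d h k r d = trans (sym (*-assoc (A ⊛ B) c C)) (trans (*-congʳ (*-comm (A ⊛ B) c)) (*-assoc c (A ⊛ B) C))
      where A = a ^ (r ∸ d); B = b ^ (h + k ∸ d); C = c ^ d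

    monomial-h : ∀ h k {r d} → d ≤ r → monomial h k (suc r) d ≈ a ⊛ monomial h k r d
    monomial-h h k {r} {d} d≤r = begin
      a ^ (suc r ∸ d) ⊛ B ⊛ C    ≡⟨ ≡.cong (λ x → a ^ x ⊛ B ⊛ C) (ℕ.+-∸-assoc 1 d≤r) ⟩
      (a ⊛ A) ⊛ B ⊛ C            ≈⟨ trans (*-congʳ (*-assoc a A B)) (*-assoc a (A ⊛ B) C) ⟩
      a ⊛ (A ⊛ B ⊛ C)            ∎
      where A = a ^ (r ∸ d); B = b ^ (h + k ∸ d); C = c ^ d

    monomial-v : ∀ h k r {d} → d ≤ h + k → monomial (suc h) k r d ≈ b ⊛ monomial h k r d
    monomial-v h k r {d} d≤h+k = begin
      A ⊛ b ^ (suc h + k ∸ d) ⊛ C  ≡⟨ ≡.cong (λ x → A ⊛ b ^ x ⊛ C) (ℕ.+-∸-assoc 1 d≤h+k) ⟩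
      A ⊛ (b ⊛ B) ⊛ C              ≈⟨ *-congʳ (trans (sym (*-assoc A b B)) (trans (*-congʳ (*-comm A b)) (*-assoc b A B))) ⟩
      b ⊛ (A ⊛ B) ⊛ C              ≈⟨ *-assoc b (A ⊛ B) C ⟩
      b ⊛ (A ⊛ B ⊛ C)              ∎
      where A = a ^ (r ∸ d); B = b ^ (h + k ∸ d); C = c ^ d

    weighted-cong : ∀ {f g : Count} → (∀ h k d m → f h k d m ≡ g h k d m) →
      ∀ h n → weighted f h n ≈ weighted g h n
    weighted-cong f≡g h n =
      ∑-cong n (λ k _ → ∑-cong (n ∸ k) (λ d _ → reflexive (≡.cong (_· monomial h k (n ∸ k) d) (f≡g h k d _))))

    weighted-+ : ∀ (f g : Count) h n →
      weighted (λ h k d m → f h k d m + g h k d m) h n ≈ weighted f h n ⊕ weighted g h n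
    weighted-+ f g h n = trans
      (∑-cong n (λ k _ → trans (∑-cong (n ∸ k) (λ d _ → ×-homo-+ _ (f h k d _) _)) (∑-distrib-⊕ (n ∸ k) _ _)))
      (∑-distrib-⊕ n (λ k → weightedₖ f h k (n ∸ k)) (λ k → weightedₖ g h k (n ∸ k)))

    weighted-sum : ∀ {A : Set} (F : A → Count) xs h n →
      weighted (λ h k d m → sum (map (λ x → F x h k d m) xs)) h n ≈ sumList (map (λ x → weighted (F x) h n) xs)
    weighted-sum F xs h n = trans
      (∑-cong n (λ k _ → trans (∑-cong (n ∸ k) (λ d _ → sum-·-distrib _ xs _))
                               (∑-sumList (n ∸ k) (λ x d → F x h k d (n ∸ k ∸ d) · monomial h k (n ∸ k) d) xs)))
      (∑-sumList n (λ x k → weightedₖ (F x) h k (n ∸ k)) xs)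

    weighted-vanishes : ∀ (f : Count) h n → (∀ k d → f h k d (n ∸ k ∸ d) ≡ 0) → weighted f h n ≈ 0#
    weighted-vanishes f h n f≡0 =
      ∑-zero n (λ k _ → ∑-zero (n ∸ k) (λ d _ → reflexive (≡.cong (_· monomial h k (n ∸ k) d) (f≡0 k d))))

    weighted-suc : ∀ (f : Count) h n → (∀ k → f h k 0 0 ≡ 0) →
      weighted f h (suc n) ≈ ∑ n (λ k → weightedₖ f h k (suc (n ∸ k)))
    weighted-suc f h n f≡0 = trans
      (∑-dropLast n _ (reflexive (≡.trans (≡.cong (weightedₖ f h (suc n)) (ℕ.n∸n≡0 n))
                                          (≡.cong (_· monomial h (suc n) 0 0) (f≡0 (suc n))))))
      (∑-cong n (λ k k≤n → reflexive (≡.cong (weightedₖ f h k) (ℕ.+-∸-assoc 1 k≤n))))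

    weighted-emptyCount : ∀ h n → weighted emptyCount h n ≈ emptyWeight a b c h n
    weighted-emptyCount zero    zero    = trans (+-identityʳ _) (trans (*-identityʳ _) (*-identityʳ 1#))
    weighted-emptyCount zero    (suc n) = weighted-vanishes emptyCount 0 (suc n) nonempty
      where
      nonempty : ∀ k d → emptyCount 0 k d (suc n ∸ k ∸ d) ≡ 0
      nonempty zero    zero    = ≡.refl
      nonempty zero    (suc d) = ≡.refl
      nonempty (suc k) d       = ≡.refl
    weighted-emptyCount (suc h) n = weighted-vanishes emptyCount (suc h) n (λ _ _ → ≡.refl)

    weightedₖ-countAfterD : ∀ h k r → weightedₖ (countAfter D) (suc h) k (suc r) ≈ c ⊛ weightedₖ pathCount h k r
    weightedₖ-countAfterD h k r = begin
      weightedₖ (countAfter D) (suc h) k (suc r)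
        ≈⟨ ∑-suc r _ ⟩
      0# ⊕ ∑ r (λ d → pathCount h k d (r ∸ d) · monomial (suc h) k (suc r) (suc d))
        ≈⟨ +-identityˡ _ ⟩
      ∑ r (λ d → pathCount h k d (r ∸ d) · monomial (suc h) k (suc r) (suc d))
        ≈⟨ ∑-cong r (λ d _ → ·-pull (pathCount h k d (r ∸ d)) c (monomial-d h k r d)) ⟩
      ∑ r (λ d → c ⊛ (pathCount h k d (r ∸ d) · monomial h k r d))
        ≈⟨ *-distribˡ-∑ r c _ ⟨
      c ⊛ weightedₖ pathCount h k r
        ∎

    weightedₖ-countAfterH : ∀ h k r → weightedₖ (countAfter H) h k (suc r) ≈ a ⊛ weightedₖ pathCount h k r
    weightedₖ-countAfterH h k r = begin
      weightedₖ (countAfter H) h k (suc r)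
        ≈⟨ ∑-dropLast r _ (reflexive (≡.cong (λ m → countAfter H h k (suc r) m · monomial h k (suc r) (suc r))
                                             (ℕ.n∸n≡0 r))) ⟩
      ∑ r (λ d → countAfter H h k d (suc r ∸ d) · monomial h k (suc r) d)
        ≈⟨ ∑-cong r (λ d d≤r → trans (reflexive (≡.cong (λ m → countAfter H h k d m · monomial h k (suc r) d)
                                                        (ℕ.+-∸-assoc 1 d≤r)))
                                     (·-pull (pathCount h k d (r ∸ d)) a (monomial-h h k d≤r))) ⟩
      ∑ r (λ d → a ⊛ (pathCount h k d (r ∸ d) · monomial h k r d))
        ≈⟨ *-distribˡ-∑ r a _ ⟨
      a ⊛ weightedₖ pathCount h k r
        ∎

    weightedₖ-countAfterV : ∀ h k r → weightedₖ (countAfter V) (suc h) k r ≈ b ⊛ weightedₖ pathCount h k r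
    weightedₖ-countAfterV h k r = trans (∑-cong r term) (sym (*-distribˡ-∑ r b _))
      where
      term : ∀ d → d ≤ r →
        pathCount h k d (r ∸ d) · monomial (suc h) k r d ≈ b ⊛ (pathCount h k d (r ∸ d) · monomial h k r d)
      term d _ with d ℕ.≤? h + k
      ... | yes d≤h+k = ·-pull (pathCount h k d (r ∸ d)) b (monomial-v h k r d≤h+k)
      ... | no  d≰h+k = begin
        pathCount h k d (r ∸ d) · monomial (suc h) k r d  ≡⟨ ≡.cong (_· monomial (suc h) k r d) vanishes ⟩
        0#                                                ≈⟨ zeroʳ b ⟨
        b ⊛ 0#                                            ≡⟨ ≡.cong (λ m → b ⊛ (m · monomial h k r d)) vanishes ⟨
        b ⊛ (pathCount h k d (r ∸ d) · monomial h k r d)  ∎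
        where vanishes = pathCount-vanishes h k d (r ∸ d) (ℕ.≰⇒> d≰h+k)

    weighted-countAfter : ∀ s h n → weighted (countAfter s) h n ≈ after a b c s closedForm h n
    weighted-countAfter U h       zero    = refl
    weighted-countAfter U h       (suc n) = begin
      weighted (countAfter U) h (suc n)
        ≈⟨ ∑-suc n _ ⟩
      weightedₖ (countAfter U) h 0 (suc n) ⊕ ∑ n (λ k → weightedₖ (countAfter U) h (suc k) (n ∸ k))
        ≈⟨ +-cong (∑-zero (suc n) (λ _ _ → refl))
                  (∑-cong n (λ k _ → ∑-cong (n ∸ k) (λ d _ →
                     reflexive (≡.cong (pathCount (suc h) k d (n ∸ k ∸ d) ·_) (monomial-u h k (n ∸ k) d))))) ⟩
      0# ⊕ closedForm (suc h) n
        ≈⟨ +-identityˡ _ ⟩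
      closedForm (suc h) n
        ∎
    weighted-countAfter D zero    n       = weighted-vanishes (countAfter D) 0 n (λ _ _ → ≡.refl)
    weighted-countAfter D (suc h) zero    = refl
    weighted-countAfter D (suc h) (suc n) = begin
      weighted (countAfter D) (suc h) (suc n)                       ≈⟨ weighted-suc (countAfter D) (suc h) n (λ _ → ≡.refl) ⟩
      ∑ n (λ k → weightedₖ (countAfter D) (suc h) k (suc (n ∸ k)))  ≈⟨ ∑-cong n (λ k _ → weightedₖ-countAfterD h k (n ∸ k)) ⟩
      ∑ n (λ k → c ⊛ weightedₖ pathCount h k (n ∸ k))               ≈⟨ *-distribˡ-∑ n c _ ⟨
      c ⊛ closedForm h n                                            ∎
    weighted-countAfter H h       zero    = refl
    weighted-countAfter H h       (suc n) = begin
      weighted (countAfter H) h (suc n)                       ≈⟨ weighted-suc (countAfter H) h n (λ _ → ≡.refl) ⟩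
      ∑ n (λ k → weightedₖ (countAfter H) h k (suc (n ∸ k)))  ≈⟨ ∑-cong n (λ k _ → weightedₖ-countAfterH h k (n ∸ k)) ⟩
      ∑ n (λ k → a ⊛ weightedₖ pathCount h k (n ∸ k))         ≈⟨ *-distribˡ-∑ n a _ ⟨
      a ⊛ closedForm h n                                      ∎
    weighted-countAfter V zero    n       = weighted-vanishes (countAfter V) 0 n (λ _ _ → ≡.refl)
    weighted-countAfter V (suc h) n       =
      trans (∑-cong n (λ k _ → weightedₖ-countAfterV h k (n ∸ k))) (sym (*-distribˡ-∑ n b _))

    closedForm-solves : IsFirstStepSolution a b c closedForm
    closedForm-solves h n = begin
      weighted pathCount h n
        ≈⟨ weighted-cong pathCount-firstStep h n ⟩
      weighted (λ h k d m → emptyCount h k d m + sum (map (λ s → countAfter s h k d m) allSteps)) h n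
        ≈⟨ weighted-+ emptyCount (λ h k d m → sum (map (λ s → countAfter s h k d m) allSteps)) h n ⟩
      weighted emptyCount h n ⊕ weighted (λ h k d m → sum (map (λ s → countAfter s h k d m) allSteps)) h n
        ≈⟨ +-congˡ (weighted-sum countAfter allSteps h n) ⟩
      weighted emptyCount h n ⊕ sumList (map (λ s → weighted (countAfter s) h n) allSteps)
        ≈⟨ +-cong (weighted-emptyCount h n) (sumList-map-cong allSteps (λ s → weighted-countAfter s h n)) ⟩
      emptyWeight a b c h n ⊕ firstStep a b c closedForm h n
        ∎

module Reindexing where
  open import Data.Nat using (_+_; _*_; _∸_; _≤_; _<_)
  open import Data.Nat.Properties
  open import Data.Nat.Combinatorics using (_C_)
  open import Data.Nat.Solver using (module +-*-Solver)
  open import Relation.Binary.PropositionalEquality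
  open ≡-Reasoning

  open Ballot
  open PathCount using (pathCount)

  n+k≡2k+[n∸k] : ∀ {n k} → k ≤ n → n + k ≡ 2 * k + (n ∸ k)
  n+k≡2k+[n∸k] {n} {k} k≤n = begin
    n + k                ≡⟨ cong (_+ k) (m+[n∸m]≡n k≤n) ⟨
    k + (n ∸ k) + k      ≡⟨ +-*-Solver.solve 2 (λ k r → k :+ r :+ k := con 2 :* k :+ r) refl k (n ∸ k) ⟩
    2 * k + (n ∸ k)      ∎
    where open +-*-Solver using (_:+_; _:*_; _:=_; con)

  n+k∸j≡2k+[n∸k∸j] : ∀ {n k j} → k ≤ n → j ≤ n ∸ k → n + k ∸ j ≡ 2 * k + (n ∸ k ∸ j)
  n+k∸j≡2k+[n∸k∸j] {n} {k} {j} k≤n j≤n∸k =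
    trans (cong (_∸ j) (n+k≡2k+[n∸k] k≤n)) (+-∸-assoc (2 * k) j≤n∸k)

  n+k∸[n∸k∸j]≡2k+j : ∀ {n k j} → k ≤ n → j ≤ n ∸ k → n + k ∸ (n ∸ k ∸ j) ≡ 2 * k + j
  n+k∸[n∸k∸j]≡2k+j {n} {k} {j} k≤n j≤n∸k = begin
    n + k ∸ (n ∸ k ∸ j)              ≡⟨ cong (_∸ (n ∸ k ∸ j)) (n+k≡2k+[n∸k] k≤n) ⟩
    2 * k + (n ∸ k) ∸ (n ∸ k ∸ j)    ≡⟨ +-∸-assoc (2 * k) (m∸n≤m (n ∸ k) j) ⟩
    2 * k + (n ∸ k ∸ (n ∸ k ∸ j))    ≡⟨ cong (2 * k +_) (m∸[m∸n]≡n j≤n∸k) ⟩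
    2 * k + j                        ∎

  k∸[n∸k∸j]≡2k+j∸n : ∀ {n k j} → k ≤ n → j ≤ n ∸ k → k ∸ (n ∸ k ∸ j) ≡ 2 * k + j ∸ n
  k∸[n∸k∸j]≡2k+j∸n {n} {k} {j} k≤n j≤n∸k = begin
    k ∸ (r ∸ j)                      ≡⟨ [m+n]∸[m+o]≡n∸o j k (r ∸ j) ⟨
    j + k ∸ (j + (r ∸ j))            ≡⟨ cong₂ _∸_ (+-comm j k) (m+[n∸m]≡n j≤n∸k) ⟩
    k + j ∸ r                        ≡⟨ [m+n]∸[m+o]≡n∸o k (k + j) r ⟨
    k + (k + j) ∸ (k + r)            ≡⟨ cong₂ _∸_ (trans (cong (_+ j) (2*k≡k+k k)) (+-assoc k k j)) (sym (m+[n∸m]≡n k≤n)) ⟨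
    2 * k + j ∸ n                    ∎
    where r = n ∸ k

  n+k∸[k∸i]≡n+i : ∀ n {k i} → i ≤ k → n + k ∸ (k ∸ i) ≡ n + i
  n+k∸[k∸i]≡n+i n {k} {i} i≤k = trans (+-∸-assoc n (m∸n≤m k i)) (cong (n +_) (m∸[m∸n]≡n i≤k))

  n∸k∸[k∸i]≡n+i∸2k : ∀ n {k i} → i ≤ k → n ∸ k ∸ (k ∸ i) ≡ n + i ∸ 2 * k
  n∸k∸[k∸i]≡n+i∸2k n {k} {i} i≤k = begin
    n ∸ k ∸ (k ∸ i)                  ≡⟨ ∸-+-assoc n k (k ∸ i) ⟩
    n ∸ (k + (k ∸ i))                ≡⟨ [m+n]∸[m+o]≡n∸o i n (k + (k ∸ i)) ⟨
    i + n ∸ (i + (k + (k ∸ i)))      ≡⟨ cong₂ _∸_ (+-comm n i) 2k≡i+[k+[k∸i]] ⟨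
    n + i ∸ 2 * k                    ∎
    where
    2k≡i+[k+[k∸i]] : 2 * k ≡ i + (k + (k ∸ i))
    2k≡i+[k+[k∸i]] = begin
      2 * k                 ≡⟨ 2*k≡k+k k ⟩
      k + k                 ≡⟨ cong (k +_) (m+[n∸m]≡n i≤k) ⟨
      k + (i + (k ∸ i))     ≡⟨ +-*-Solver.solve 3 (λ k i l → k :+ (i :+ l) := i :+ (k :+ l)) refl k i (k ∸ i) ⟩
      i + (k + (k ∸ i))     ∎
      where open +-*-Solver using (_:+_; _:=_)

  n+k∸j<2k : ∀ {n k j} → k ≤ n → n ∸ k < j → j ≤ n → n + k ∸ j < 2 * k
  n+k∸j<2k {n} {k} {j} k≤n n∸k<j j≤n = subst (n + k ∸ j <_) (m+n∸n≡m (2 * k) j)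
    (∸-monoˡ-< n+k<2k+j (≤-trans j≤n (m≤m+n n k)))
    where
    n+k<2k+j : n + k < 2 * k + j
    n+k<2k+j = subst (_< 2 * k + j) (sym (n+k≡2k+[n∸k] k≤n)) (+-monoʳ-< (2 * k) n∸k<j)

  pathCount-from-axis : ∀ {n k j} → k ≤ n → j ≤ n ∸ k →
    pathCount 0 k j (n ∸ k ∸ j) ≡ (k C j) * ((n + k ∸ j) C (2 * k)) * catalan k
  pathCount-from-axis {n} {k} {j} k≤n j≤n∸k = begin
    ballot k 0 * (k C j) * ((0 +2* k + m) C m)
      ≡⟨ cong (λ x → ballot k 0 * (k C j) * ((x + m) C m)) (0+2*k≡2*k k) ⟩
    ballot k 0 * (k C j) * ((2 * k + m) C m)
      ≡⟨ cong (ballot k 0 * (k C j) *_) ([m+n]Cn≡[m+n]Cm (2 * k) m) ⟩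
    ballot k 0 * (k C j) * ((2 * k + m) C (2 * k))
      ≡⟨ cong₂ (λ x y → x * (k C j) * (y C (2 * k))) (ballot-k-0≡catalan k) (sym (n+k∸j≡2k+[n∸k∸j] k≤n j≤n∸k)) ⟩
    catalan k * (k C j) * ((n + k ∸ j) C (2 * k))
      ≡⟨ +-*-Solver.solve 3 (λ x y z → x :* y :* z := y :* z :* x) refl (catalan k) (k C j) _ ⟩
    (k C j) * ((n + k ∸ j) C (2 * k)) * catalan k
      ∎
    where
    m = n ∸ k ∸ j
    open +-*-Solver using (_:*_; _:=_)

module ThreeForms {c ℓ : Level} (R : CommutativeSemiring c ℓ) where
  open import Data.Nat using (_+_; _*_; _∸_; _≤_; _<_)
  import Data.Nat.Properties as ℕ
  open import Data.Nat.Combinatorics using (_C_; nCk≡nC[n∸k]; k>n⇒nCk≡0)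
  open import Relation.Binary.PropositionalEquality as ≡ using (_≡_)
  open CommutativeSemiring R hiding (zero) renaming (_+_ to _⊕_; _*_ to _⊛_)
  open import Algebra.Definitions.RawSemiring rawSemiring using (_^_) renaming (_×_ to _·_)
  open Weighted R
  open Sums R
  open ClosedForm R using (closedForm)
  open Ballot using ([m+n]Cn≡[m+n]Cm)
  open Reindexing
  open import Relation.Binary.Reasoning.Setoid setoid

  module _ (a b c : Carrier) where

    term₁ : ℕ → ℕ → ℕ → Carrier
    term₁ n k j = ((k C j) * ((n + k ∸ j) C (2 * k)) * catalan k) · (a ^ (n ∸ k ∸ j) ⊛ b ^ (k ∸ j) ⊛ c ^ j)

    sum₁≈closedForm : ∀ n → sum₁ n a b c ≈ closedForm a b c 0 n
    sum₁≈closedForm n = ∑-cong n (λ k k≤n → ∑-cong (n ∸ k) (λ j j≤n∸k →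
      reflexive (≡.cong (_· (a ^ (n ∸ k ∸ j) ⊛ b ^ (k ∸ j) ⊛ c ^ j)) (≡.sym (pathCount-from-axis k≤n j≤n∸k)))))

    -- Both k C j and (n + k − j) C 2k cut off the inner sum of the first form.
    ∑-term₁ : ∀ n k → k ≤ n → ∑ k (term₁ n k) ≈ ∑ (n ∸ k) (term₁ n k)
    ∑-term₁ n k k≤n =
      trans (sym (∑-truncate n (term₁ n k) k≤n beyondK)) (∑-truncate n (term₁ n k) (ℕ.m∸n≤m n k) beyondN∸K)
      where
      vanishing : ∀ j → (k C j) * ((n + k ∸ j) C (2 * k)) * catalan k ≡ 0 → term₁ n k j ≈ 0#
      vanishing j coefficient≡0 = reflexive (≡.cong (_· (a ^ (n ∸ k ∸ j) ⊛ b ^ (k ∸ j) ⊛ c ^ j)) coefficient≡0)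
      beyondK : ∀ j → k < j → j ≤ n → term₁ n k j ≈ 0#
      beyondK j k<j _ = vanishing j (≡.cong (λ x → x * ((n + k ∸ j) C (2 * k)) * catalan k) (k>n⇒nCk≡0 k<j))
      beyondN∸K : ∀ j → n ∸ k < j → j ≤ n → term₁ n k j ≈ 0#
      beyondN∸K j n∸k<j j≤n = vanishing j (≡.trans
        (≡.cong (λ x → (k C j) * x * catalan k) (k>n⇒nCk≡0 (n+k∸j<2k k≤n n∸k<j j≤n)))
        (≡.cong (_* catalan k) (ℕ.*-zeroʳ (k C j))))

    term₂ term₃ : ℕ → ℕ → ℕ → Carrier
    term₂ n k i = ((k C i) * ((n + i) C (2 * k)) * catalan k) · (a ^ (n + i ∸ 2 * k) ⊛ b ^ i ⊛ c ^ (k ∸ i))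
    term₃ n k j = (((2 * k + j) C j) * (k C (n ∸ k ∸ j)) * catalan k) · (a ^ j ⊛ b ^ (2 * k + j ∸ n) ⊛ c ^ (n ∸ k ∸ j))

    term₂≡term₁ : ∀ n {k i} → i ≤ k → term₂ n k i ≡ term₁ n k (k ∸ i)
    term₂≡term₁ n {k} {i} i≤k = ≡.cong₂ _·_
      (≡.cong₂ (λ x y → x * (y C (2 * k)) * catalan k) (nCk≡nC[n∸k] i≤k) (≡.sym (n+k∸[k∸i]≡n+i n i≤k)))
      (≡.cong₂ (λ x y → a ^ x ⊛ b ^ y ⊛ c ^ (k ∸ i))
        (≡.sym (n∸k∸[k∸i]≡n+i∸2k n i≤k)) (≡.sym (ℕ.m∸[m∸n]≡n i≤k)))

    term₃≡term₁ : ∀ {n k j} → k ≤ n → j ≤ n ∸ k → term₃ n k j ≡ term₁ n k (n ∸ k ∸ j)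
    term₃≡term₁ {n} {k} {j} k≤n j≤n∸k = ≡.cong₂ _·_
      (≡.cong (_* catalan k) (≡.trans (ℕ.*-comm ((2 * k + j) C j) (k C (n ∸ k ∸ j)))
        (≡.cong ((k C (n ∸ k ∸ j)) *_)
          (≡.trans ([m+n]Cn≡[m+n]Cm (2 * k) j) (≡.cong (_C (2 * k)) (≡.sym (n+k∸[n∸k∸j]≡2k+j k≤n j≤n∸k)))))))
      (≡.cong₂ (λ x y → a ^ x ⊛ b ^ y ⊛ c ^ (n ∸ k ∸ j))
        (≡.sym (ℕ.m∸[m∸n]≡n j≤n∸k)) (≡.sym (k∸[n∸k∸j]≡2k+j∸n k≤n j≤n∸k)))

    sum₂≈sum₁ : ∀ n → sum₂ n a b c ≈ sum₁ n a b c
    sum₂≈sum₁ n = ∑-cong n (λ k k≤n → begin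
      ∑ k (term₂ n k)                ≈⟨ ∑-cong k (λ i i≤k → reflexive (term₂≡term₁ n i≤k)) ⟩
      ∑ k (λ i → term₁ n k (k ∸ i))  ≈⟨ ∑-reverse k (term₁ n k) ⟨
      ∑ k (term₁ n k)                ≈⟨ ∑-term₁ n k k≤n ⟩
      ∑ (n ∸ k) (term₁ n k)          ∎)

    sum₃≈sum₁ : ∀ n → sum₃ n a b c ≈ sum₁ n a b c
    sum₃≈sum₁ n = ∑-cong n (λ k k≤n → begin
      ∑ (n ∸ k) (term₃ n k)                    ≈⟨ ∑-cong (n ∸ k) (λ j j≤n∸k → reflexive (term₃≡term₁ k≤n j≤n∸k)) ⟩
      ∑ (n ∸ k) (λ j → term₁ n k (n ∸ k ∸ j))  ≈⟨ ∑-reverse (n ∸ k) (term₁ n k) ⟨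
      ∑ (n ∸ k) (term₁ n k)                    ∎)

proposition2p1 : ∀ {c ℓ : Level} (R : CommutativeSemiring c ℓ) →
    let open CommutativeSemiring R in
    let open Weighted R in
    (a b c : Carrier) (n : ℕ) →
    (G n a b c ≈ sum₁ n a b c) × (G n a b c ≈ sum₂ n a b c) × (G n a b c ≈ sum₃ n a b c)
proposition2p1 R a b c n =
  G≈sum₁ , trans G≈sum₁ (sym (sum₂≈sum₁ a b c n)) , trans G≈sum₁ (sym (sum₃≈sum₁ a b c n))
  where
  open CommutativeSemiring R
  open Weighted R
  open Enumeration R using (G≈solution)
  open ClosedForm R using (closedForm-solves)
  open ThreeForms R using (sum₁≈closedForm; sum₂≈sum₁; sum₃≈sum₁)
  G≈sum₁ : G n a b c ≈ sum₁ n a b c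
  G≈sum₁ = trans (G≈solution a b c (closedForm-solves a b c) n) (sym (sum₁≈closedForm a b c n))
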